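{- Let $a,k$ be integers with either $a\ge2$ and $k\ge3$, or $a=1$ and $k\ge4$. Then $$\sum_{i=0}^{ak+1}\binom{(2a+1)k+3}{i}a^i<\binom{(2a+1)k+3}{ak+2}a^{ak+1}.$$ -}

module Defs where

open import Data.Nat using (ℕ; zero; suc; _+_)

sumTo : ℕ → (ℕ → ℕ) → ℕ
sumTo zero    f = f zero
sumTo (suc n) f = sumTo n f + f (suc n)

{-# OPTIONS --safe #-}
module Submission where

open import Defs
open import Data.Nat using (ℕ; zero; suc; _+_; _*_; _∸_; _^_; _≤_; _<_; _≤?_; NonZero; >-nonZero; s≤s; z<s)
open import Data.Nat.Properties
open import Data.Nat.Combinatorics using (_C_; nC1≡n; nCk+nC[k+1]≡[n+1]C[k+1]; k>n⇒nCk≡0)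
open import Data.Nat.Tactic.RingSolver using (solve-∀)
open import Data.Sum using (_⊎_; inj₁; inj₂)
open import Data.Product using (_×_; _,_)
open import Relation.Binary.PropositionalEquality
open import Relation.Nullary using (yes; no)
open import Algebra.Properties.CommutativeSemigroup *-commutativeSemigroup using (x∙yz≈y∙xz)

-- With N = (2a+1)k+3 and t i = C(N,i)·aⁱ the claim reads a·(t 0 + … + t (ak+1)) < t (ak+2).
-- The ratios t (i+1) / t i = (N−i)a/(i+1) decrease, so comparing with a geometric series bounds
-- S j = t 0 + … + t j by S j / t (j+1) ≤ (j+1)/((N−j)a − (j+1)). That bound is too weak at
-- j = ak+1, so it is taken at j = ak−2 and carried exactly through the last three terms; what
-- remains is a polynomial inequality in a and k whose difference has only positive coefficients.

[1+k]*nC[1+k]≡[n∸k]*nCk : ∀ n k → suc k * (n C suc k) ≡ (n ∸ k) * (n C k)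
[1+k]*nC[1+k]≡[n∸k]*nCk zero    zero    = refl
[1+k]*nC[1+k]≡[n∸k]*nCk zero    (suc k) = *-zeroʳ (2 + k)
[1+k]*nC[1+k]≡[n∸k]*nCk (suc n) zero    =
  trans (+-identityʳ _) (trans (nC1≡n (suc n)) (sym (*-identityʳ (suc n))))
[1+k]*nC[1+k]≡[n∸k]*nCk (suc n) (suc k) with suc k ≤? n
... | yes k<n = begin
  (2 + k) * (suc n C (2 + k))                        ≡⟨ cong ((2 + k) *_) (nCk+nC[k+1]≡[n+1]C[k+1] n (suc k)) ⟨
  (2 + k) * (n C suc k + n C (2 + k))                ≡⟨ *-distribˡ-+ (2 + k) (n C suc k) _ ⟩
  (2 + k) * (n C suc k) + (2 + k) * (n C (2 + k))    ≡⟨ cong ((2 + k) * (n C suc k) +_) ([1+k]*nC[1+k]≡[n∸k]*nCk n (suc k)) ⟩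
  (2 + k) * (n C suc k) + (n ∸ suc k) * (n C suc k)  ≡⟨ *-distribʳ-+ (n C suc k) (2 + k) (n ∸ suc k) ⟨
  (2 + k + (n ∸ suc k)) * (n C suc k)                ≡⟨ cong (_* (n C suc k)) factors ⟩
  (suc k + (n ∸ k)) * (n C suc k)                    ≡⟨ *-distribʳ-+ (n C suc k) (suc k) (n ∸ k) ⟩
  suc k * (n C suc k) + (n ∸ k) * (n C suc k)        ≡⟨ cong (_+ (n ∸ k) * (n C suc k)) ([1+k]*nC[1+k]≡[n∸k]*nCk n k) ⟩
  (n ∸ k) * (n C k) + (n ∸ k) * (n C suc k)          ≡⟨ *-distribˡ-+ (n ∸ k) (n C k) _ ⟨
  (n ∸ k) * (n C k + n C suc k)                      ≡⟨ cong ((n ∸ k) *_) (nCk+nC[k+1]≡[n+1]C[k+1] n k) ⟩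
  (n ∸ k) * (suc n C suc k)                          ∎
  where
  open ≡-Reasoning
  factors : 2 + k + (n ∸ suc k) ≡ suc k + (n ∸ k)
  factors = cong suc (trans (sym (+-suc k (n ∸ suc k))) (cong (k +_) (sym (+-∸-assoc 1 k<n))))
... | no k≮n = begin
  (2 + k) * (suc n C (2 + k))  ≡⟨ cong ((2 + k) *_) (k>n⇒nCk≡0 (s≤s (≰⇒> k≮n))) ⟩
  (2 + k) * 0                  ≡⟨ *-zeroʳ (2 + k) ⟩
  0 * (suc n C suc k)          ≡⟨ cong (_* (suc n C suc k)) (m≤n⇒m∸n≡0 (≤-pred (≰⇒> k≮n))) ⟨
  (n ∸ k) * (suc n C suc k)    ∎
  where open ≡-Reasoning

nCk>0 : ∀ {n k} → k ≤ n → 0 < n C k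
nCk>0 {n}     {zero}  _         = z<s
nCk>0 {suc n} {suc k} (s≤s k≤n) =
  subst (0 <_) (nCk+nC[k+1]≡[n+1]C[k+1] n k) (<-≤-trans (nCk>0 k≤n) (m≤m+n _ _))

binomialTerm : ℕ → ℕ → ℕ → ℕ
binomialTerm N a i = (N C i) * a ^ i

binomialTerm-ratio : ∀ N a i →
  binomialTerm N a (suc i) * suc i ≡ binomialTerm N a i * ((N ∸ i) * a)
binomialTerm-ratio N a i = begin
  ((N C suc i) * (a * a ^ i)) * suc i  ≡⟨ regroupˡ (N C suc i) a (a ^ i) (suc i) ⟩
  (suc i * (N C suc i)) * (a * a ^ i)  ≡⟨ cong (_* (a * a ^ i)) ([1+k]*nC[1+k]≡[n∸k]*nCk N i) ⟩
  ((N ∸ i) * (N C i)) * (a * a ^ i)    ≡⟨ regroupʳ (N ∸ i) (N C i) a (a ^ i) ⟩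
  ((N C i) * a ^ i) * ((N ∸ i) * a)    ∎
  where
  open ≡-Reasoning
  regroupˡ : ∀ c a p s → (c * (a * p)) * s ≡ (s * c) * (a * p)
  regroupˡ = solve-∀
  regroupʳ : ∀ d c a p → (d * c) * (a * p) ≡ (c * p) * (d * a)
  regroupʳ = solve-∀

sumTo-ratio-≤ : (t A : ℕ → ℕ) → (∀ i → t (suc i) * suc i ≡ t i * A i) → (∀ i → A (suc i) ≤ A i) →
                ∀ j → sumTo j t * A j ≤ sumTo (suc j) t * suc j
sumTo-ratio-≤ t A ratio antitone zero = begin
  t 0 * A 0        ≡⟨ ratio 0 ⟨
  t 1 * 1          ≤⟨ *-monoˡ-≤ 1 (m≤n+m (t 1) (t 0)) ⟩
  (t 0 + t 1) * 1  ∎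
  where open ≤-Reasoning
sumTo-ratio-≤ t A ratio antitone (suc j) = begin
  (S + u) * A′                    ≡⟨ *-distribʳ-+ A′ S u ⟩
  S * A′ + u * A′                 ≤⟨ +-monoˡ-≤ (u * A′) (*-monoʳ-≤ S (antitone j)) ⟩
  S * A j + u * A′                ≤⟨ +-mono-≤ (sumTo-ratio-≤ t A ratio antitone j) (≤-reflexive (sym (ratio (suc j)))) ⟩
  (S + u) * suc j + w * (2 + j)   ≤⟨ +-monoˡ-≤ (w * (2 + j)) (*-monoʳ-≤ (S + u) (n≤1+n (suc j))) ⟩
  (S + u) * (2 + j) + w * (2 + j) ≡⟨ *-distribʳ-+ (2 + j) (S + u) w ⟨
  (S + u + w) * (2 + j)           ∎
  where
  open ≤-Reasoning
  S = sumTo j t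
  u = t (suc j)
  w = t (2 + j)
  A′ = A (suc j)

-- S * E ≤ u * B reads S/u ≤ B/E; the step adds u to S and passes to the next term v = u·a/b.
ratio-bound-step : ∀ S u v B E a b → S * E ≤ u * B → v * b ≡ u * a → (S + u) * (E * a) ≤ v * ((B + E) * b)
ratio-bound-step S u v B E a b S*E≤u*B ratio = begin
  (S + u) * (E * a)         ≡⟨ *-distribʳ-+ (E * a) S u ⟩
  S * (E * a) + u * (E * a) ≡⟨ cong (_+ u * (E * a)) (*-assoc S E a) ⟨
  S * E * a + u * (E * a)   ≤⟨ +-monoˡ-≤ (u * (E * a)) (*-monoˡ-≤ a S*E≤u*B) ⟩
  u * B * a + u * (E * a)   ≡⟨ regroup u B E a ⟩
  u * a * (B + E)           ≡⟨ cong (_* (B + E)) ratio ⟨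
  v * b * (B + E)           ≡⟨ regroup′ v b B E ⟩
  v * ((B + E) * b)         ∎
  where
  open ≤-Reasoning
  regroup : ∀ u B E a → u * B * a + u * (E * a) ≡ u * a * (B + E)
  regroup = solve-∀
  regroup′ : ∀ v b B E → v * b * (B + E) ≡ v * ((B + E) * b)
  regroup′ = solve-∀

ratio-bound⇒< : ∀ S Z c B E → S * E ≤ (c * Z) * B → c * B < E → 0 < Z → S < Z
ratio-bound⇒< S Z c B E S*E≤cZ*B c*B<E Z>0 = *-cancelʳ-< E S Z (begin-strict
  S * E        ≤⟨ S*E≤cZ*B ⟩
  (c * Z) * B  ≡⟨ regroup c Z B ⟩
  Z * (c * B)  <⟨ *-monoʳ-< Z c*B<E ⟩
  Z * E        ∎)
  where
  open ≤-Reasoning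
  instance _ = >-nonZero Z>0
  regroup : ∀ c Z B → (c * Z) * B ≡ Z * (c * B)
  regroup = solve-∀

[j+m]∸[i+j]≡m∸i : ∀ j m i → (j + m) ∸ (i + j) ≡ m ∸ i
[j+m]∸[i+j]≡m∸i j m i = trans (cong (j + m ∸_) (+-comm i j)) ([m+n]∸[m+o]≡n∸o j m i)

sumTo-binomialTerm-< : ∀ a j n e .{{_ : NonZero a}} → (4 + n) * a ≡ suc j + e →
  let a₁ = (3 + n) * a ; a₂ = (2 + n) * a ; a₃ = (1 + n) * a in
  a * ((((suc j + e) * (2 + j) + e * a₁) * (3 + j) + e * a₁ * a₂) * (4 + j)) < e * a₁ * a₂ * a₃ →
  sumTo (3 + j) (binomialTerm (j + (4 + n)) a) < ((j + (4 + n)) C (4 + j)) * a ^ (3 + j)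
sumTo-binomialTerm-< a j n e A≡ margin = ratio-bound⇒< (sumTo (3 + j) t) Z a B₃ E₃ bound₃ margin Z>0
  where
  N = j + (4 + n)
  t = binomialTerm N a
  Z = (N C (4 + j)) * a ^ (3 + j)
  a₁ = (3 + n) * a
  a₂ = (2 + n) * a
  a₃ = (1 + n) * a
  B₁ = (suc j + e) * (2 + j)
  E₁ = e * a₁
  B₂ = (B₁ + E₁) * (3 + j)
  E₂ = E₁ * a₂
  B₃ = (B₂ + E₂) * (4 + j)
  E₃ = E₂ * a₃
  ratio : ∀ i → t (suc (i + j)) * suc (i + j) ≡ t (i + j) * (((4 + n) ∸ i) * a)
  ratio i = trans (binomialTerm-ratio N a (i + j)) (cong (λ d → t (i + j) * (d * a)) ([j+m]∸[i+j]≡m∸i j (4 + n) i))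
  geometric : sumTo j t * e ≤ t (suc j) * suc j
  geometric = +-cancelˡ-≤ (sumTo j t * suc j) _ _ (begin
    sumTo j t * suc j + sumTo j t * e  ≡⟨ *-distribˡ-+ (sumTo j t) (suc j) e ⟨
    sumTo j t * (suc j + e)            ≡⟨ cong (sumTo j t *_) A≡ ⟨
    sumTo j t * ((4 + n) * a)          ≡⟨ cong (λ d → sumTo j t * (d * a)) (m+n∸m≡n j (4 + n)) ⟨
    sumTo j t * ((N ∸ j) * a)          ≤⟨ sumTo-ratio-≤ t (λ i → (N ∸ i) * a) (binomialTerm-ratio N a) antitone j ⟩
    sumTo (suc j) t * suc j            ≡⟨ *-distribʳ-+ (suc j) (sumTo j t) (t (suc j)) ⟩
    sumTo j t * suc j + t (suc j) * suc j ∎)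
    where
    open ≤-Reasoning
    antitone : ∀ i → (N ∸ suc i) * a ≤ (N ∸ i) * a
    antitone i = *-monoˡ-≤ a (∸-monoʳ-≤ N (n≤1+n i))
  a*Z≡t[4+j] : a * Z ≡ t (4 + j)
  a*Z≡t[4+j] = x∙yz≈y∙xz a (N C (4 + j)) (a ^ (3 + j))
  bound₁ : sumTo (1 + j) t * E₁ ≤ t (2 + j) * B₁
  bound₁ = ratio-bound-step (sumTo j t) (t (1 + j)) (t (2 + j)) (suc j) e a₁ (2 + j) geometric (ratio 1)
  bound₂ : sumTo (2 + j) t * E₂ ≤ t (3 + j) * B₂
  bound₂ = ratio-bound-step (sumTo (1 + j) t) (t (2 + j)) (t (3 + j)) B₁ E₁ a₂ (3 + j) bound₁ (ratio 2)
  bound₃ : sumTo (3 + j) t * E₃ ≤ (a * Z) * B₃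
  bound₃ = ratio-bound-step (sumTo (2 + j) t) (t (3 + j)) (a * Z) B₂ E₂ a₃ (4 + j) bound₂
             (trans (cong (_* (4 + j)) a*Z≡t[4+j]) (ratio 3))
  Z>0 : 0 < Z
  Z>0 = *-mono-≤ (nCk>0 (subst (4 + j ≤_) (+-comm (4 + n) j) (+-monoˡ-≤ j (m≤m+n 4 n)))) (m^n>0 a (3 + j))

m+1+n≡o⇒m<o : ∀ {m n o} → m + suc n ≡ o → m < o
m+1+n≡o⇒m<o {m} refl = m<m+n m z<s

sumTo-binomialTerm-<-reindex : ∀ a k j n → a * k + 1 ≡ 3 + j → (2 * a + 1) * k + 3 ≡ j + (4 + n) →
  sumTo (3 + j) (binomialTerm (j + (4 + n)) a) < ((j + (4 + n)) C (4 + j)) * a ^ (3 + j) →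
  sumTo (a * k + 1) (binomialTerm ((2 * a + 1) * k + 3) a)
    < (((2 * a + 1) * k + 3) C (a * k + 2)) * a ^ (a * k + 1)
sumTo-binomialTerm-<-reindex a k j n m≡ N≡ bound rewrite +-suc (a * k) 1 | m≡ | N≡ = bound

lemma3p5 : (a k : ℕ) → ((2 ≤ a × 3 ≤ k) ⊎ (a ≡ 1 × 4 ≤ k)) →
    sumTo (a * k + 1) (λ i → (((2 * a + 1) * k + 3) C i) * a ^ i)
      < (((2 * a + 1) * k + 3) C (a * k + 2)) * a ^ (a * k + 1)
lemma3p5 (suc (suc x)) (suc (suc (suc y))) (inj₁ (s≤s (s≤s _) , s≤s (s≤s (s≤s _)))) =
  sumTo-binomialTerm-<-reindex (2 + x) (3 + y) j n (m≡ x y) (N≡ x y)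
    (sumTo-binomialTerm-< (2 + x) j n e (A≡ x y) (m+1+n≡o⇒m<o (margin x y)))
  where
  j = 4 + 3 * x + 2 * y + x * y
  n = 10 + 3 * x + 3 * y + x * y
  e = 23 + 17 * x + 4 * y + 4 * x * y + 3 * x * x + x * x * y
  m≡ : ∀ x y → (2 + x) * (3 + y) + 1 ≡ 3 + (4 + 3 * x + 2 * y + x * y)
  m≡ = solve-∀
  N≡ : ∀ x y → (2 * (2 + x) + 1) * (3 + y) + 3 ≡ (4 + 3 * x + 2 * y + x * y) + (4 + (10 + 3 * x + 3 * y + x * y))
  N≡ = solve-∀
  A≡ : ∀ x y → (4 + (10 + 3 * x + 3 * y + x * y)) * (2 + x)
               ≡ suc (4 + 3 * x + 2 * y + x * y) + (23 + 17 * x + 4 * y + 4 * x * y + 3 * x * x + x * x * y)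
  A≡ = solve-∀
  -- a = 2 + x, k = 3 + y, j = ak − 2, n = N − ak − 2, e = (N − j)a − (j + 1).
  margin : ∀ x y →
    let a = 2 + x ; j = 4 + 3 * x + 2 * y + x * y ; n = 10 + 3 * x + 3 * y + x * y
        e = 23 + 17 * x + 4 * y + 4 * x * y + 3 * x * x + x * x * y
        a₁ = (3 + n) * a ; a₂ = (2 + n) * a ; a₃ = (1 + n) * a in
    a * ((((suc j + e) * (2 + j) + e * a₁) * (3 + j) + e * a₁ * a₂) * (4 + j))
      + (320 + 1712 * y + 760 * y * y + 88 * y * y * y + 1084 * x + 3604 * x * y + 1588 * x * y * y + 188 * x * y * y * y + 1204 * x * x + 2956 * x * x * y + 1298 * x * x * y * y + 158 * x * x * y * y * y + 587 * x * x * x + 1169 * x * x * x * y + 515 * x * x * x * y * y + 65 * x * x * x * y * y * y + 126 * x * x * x * x + 219 * x * x * x * x * y + 98 * x * x * x * x * y * y + 13 * x * x * x * x * y * y * y + 9 * x * x * x * x * x + 15 * x * x * x * x * x * y + 7 * x * x * x * x * x * y * y + x * x * x * x * x * y * y * y)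
    ≡ e * a₁ * a₂ * a₃
  margin = solve-∀
lemma3p5 .1 (suc (suc (suc (suc y)))) (inj₂ (refl , s≤s (s≤s (s≤s (s≤s _))))) =
  sumTo-binomialTerm-<-reindex 1 (4 + y) (2 + y) (9 + 2 * y) (m≡ y) (N≡ y)
    (sumTo-binomialTerm-< 1 (2 + y) (9 + 2 * y) (10 + y) (A≡ y) (m+1+n≡o⇒m<o (margin y)))
  where
  m≡ : ∀ y → 1 * (4 + y) + 1 ≡ 3 + (2 + y)
  m≡ = solve-∀
  N≡ : ∀ y → (2 * 1 + 1) * (4 + y) + 3 ≡ (2 + y) + (4 + (9 + 2 * y))
  N≡ = solve-∀
  A≡ : ∀ y → (4 + (9 + 2 * y)) * 1 ≡ suc (2 + y) + (10 + y)
  A≡ = solve-∀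
  margin : ∀ y →
    let j = 2 + y ; n = 9 + 2 * y ; e = 10 + y ; a₁ = (3 + n) * 1 ; a₂ = (2 + n) * 1 ; a₃ = (1 + n) * 1 in
    1 * ((((suc j + e) * (2 + j) + e * a₁) * (3 + j) + e * a₁ * a₂) * (4 + j))
      + (120 + 206 * y + 61 * y * y + 5 * y * y * y)
    ≡ e * a₁ * a₂ * a₃
  margin = solve-∀
lemma3p5 0 _ (inj₁ (() , _))
lemma3p5 1 _ (inj₁ (s≤s () , _))
lemma3p5 (suc (suc _)) 0 (inj₁ (_ , ()))
lemma3p5 (suc (suc _)) 1 (inj₁ (_ , s≤s ()))
lemma3p5 (suc (suc _)) 2 (inj₁ (_ , s≤s (s≤s ())))
lemma3p5 _ 0 (inj₂ (_ , ()))
lemma3p5 _ 1 (inj₂ (_ , s≤s ()))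
lemma3p5 _ 2 (inj₂ (_ , s≤s (s≤s ())))
lemma3p5 _ 3 (inj₂ (_ , s≤s (s≤s (s≤s ()))))
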